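{- Let $D=(V,A)$ be a directed graph with positive arc costs $c_a>0$ for $a\in A$, let $r\in V$ be a root and $R\subseteq V\setminus\{r\}$ a set of $b\ge 1$ terminals, each reachable from $r$. Let $OPT$ be the minimum cost of a directed Steiner tree for $(D,c,r,R)$. Then for every admissible laminar family $l\in\mathcal{L}_b$ we have $OPT(l)\le |R|\cdot OPT$.
   Context: A directed Steiner tree is an arborescence in $D$ rooted at $r$ containing a directed path from $r$ to every terminal; its cost is the sum of the costs of its arcs. Index the terminals as $R=\{t_k:k\in K\}$ with commodity set $K$, $|K|=b$. An admissible laminar family $l$ is a collection $S(l)$ of nonempty subsets of $K$ that is laminar (any two members are nested or disjoint) and contains $K$ and all singletons $\{k\}$, $k\in K$; $\mathcal{L}_b$ is the set of these. For $s\in S(l)$, $s\neq K$, its parent is the inclusion-minimal member of $S(l)$ strictly containing $s$. The subproblem $\mathcal{Z}_l$: choose for each $s\in S(l)$ a directed path $P_s$ in $D$ such that $P_K$ starts at $r$; for every $s\ne K$, $P_s$ starts at the end node of $P_{\text{parent}(s)}$; and for every $k\in K$, $P_{\{k\}}$ ends at $t_k$ (paths may be trivial, and paths of different sets may share arcs). The cost of such a solution is $\sum_{s\in S(l)}\sum_{a\in P_s}c_a$ (shared arcs counted once per set using them), and $OPT(l)$ denotes the minimum cost of a feasible solution of $\mathcal{Z}_l$.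
   Formalization: The arc costs $c_a$ are positive rationals rather than positive reals. -}

module Defs where

open import Data.Nat using (ℕ; zero; suc; _≤_)
open import Data.Fin using (Fin; zero; suc)
open import Data.Fin.Subset using (Subset; ⊤; ⁅_⁆; _⊆_; _⊂_; _∩_; Nonempty; Empty)
open import Data.Bool using (true; false; if_then_else_)
open import Data.Vec using (lookup)
open import Data.List using (List; []; _∷_; length)
import Data.List as L
open import Data.List.Relation.Unary.Unique.Propositional using (Unique)
open import Data.List.Relation.Unary.All using (All)
open import Data.List.Membership.Propositional using (_∈_)
open import Data.Rational using (ℚ; 0ℚ; _+_; _<_)
open import Data.Product using (Σ; ∃; _×_; _,_)
open import Data.Sum using (_⊎_)
open import Relation.Binary.PropositionalEquality using (_≡_; _≢_)

record Digraph (n m : ℕ) : Set where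
  field
    tail : Fin m → Fin n
    head : Fin m → Fin n
open Digraph public

data Walk {n m : ℕ} (D : Digraph n m) : Fin n → Fin n → Set where
  [] : ∀ {u} → Walk D u u
  _∷_ : ∀ {v} (a : Fin m) → Walk D (head D a) v → Walk D (tail D a) v

arcs : ∀ {n m} {D : Digraph n m} {u v} → Walk D u v → List (Fin m)
arcs [] = []
arcs (a ∷ w) = a ∷ arcs w

verts : ∀ {n m} {D : Digraph n m} {u v} → Walk D u v → List (Fin n)
verts {u = u} [] = u ∷ []
verts {D = D} (a ∷ w) = tail D a ∷ verts w

record Path {n m : ℕ} (D : Digraph n m) (u v : Fin n) : Set where
  constructor path
  field
    walk : Walk D u v
    simple : Unique (verts walk)
open Path public

costList : ∀ {m} → (Fin m → ℚ) → List (Fin m) → ℚ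
costList c [] = 0ℚ
costList c (a ∷ as) = c a + costList c as

pathCost : ∀ {n m} {D : Digraph n m} {u v} → (Fin m → ℚ) → Path D u v → ℚ
pathCost c p = costList c (arcs (walk p))

sumFin : ∀ (k : ℕ) → (Fin k → ℚ) → ℚ
sumFin zero f = 0ℚ
sumFin (suc k) f = f zero + sumFin k (λ i → f (suc i))

subsetCost : ∀ {m} → (Fin m → ℚ) → Subset m → ℚ
subsetCost {m} c F = sumFin m (λ a → if lookup F a then c a else 0ℚ)

PathIn : ∀ {n m} (D : Digraph n m) → Subset m → Fin n → Fin n → Set
PathIn D F u v = Σ (Path D u v) (λ p → All (λ a → lookup F a ≡ true) (arcs (walk p)))

IsArborescence : ∀ {n m} (D : Digraph n m) → Fin n → Subset m → Set
IsArborescence {n} {m} D r F =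
  (∀ (a : Fin m) → lookup F a ≡ true → head D a ≢ r)
  × (∀ (a a' : Fin m) → lookup F a ≡ true → lookup F a' ≡ true → head D a ≡ head D a' → a ≡ a')
  × (∀ (a : Fin m) → lookup F a ≡ true → PathIn D F r (head D a))

IsSteinerTree : ∀ {n m b} (D : Digraph n m) → Fin n → (Fin b → Fin n) → Subset m → Set
IsSteinerTree D r t F = IsArborescence D r F × (∀ k → PathIn D F r (t k))

IsOptSteiner : ∀ {n m b} (D : Digraph n m) → (Fin m → ℚ) → Fin n → (Fin b → Fin n) → ℚ → Set
IsOptSteiner {m = m} D c r t opt =
  (Σ (Subset m) (λ F → IsSteinerTree D r t F × subsetCost c F ≡ opt))
  × (∀ (F : Subset m) → IsSteinerTree D r t F → opt Data.Rational.≤ subsetCost c F)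

record Laminar (b : ℕ) : Set where
  field
    sets : List (Subset b)
    distinct : Unique sets
    nonempty : All Nonempty sets
    laminar : ∀ {s s'} → s ∈ sets → s' ∈ sets → (s ⊆ s') ⊎ (s' ⊆ s) ⊎ Empty (s ∩ s')
    hasK : ⊤ ∈ sets
    hasSingletons : ∀ (k : Fin b) → ⁅ k ⁆ ∈ sets
open Laminar public

setOf : ∀ {b} (l : Laminar b) → Fin (length (sets l)) → Subset b
setOf l i = L.lookup (sets l) i

IsParent : ∀ {b} (l : Laminar b) → Fin (length (sets l)) → Fin (length (sets l)) → Set
IsParent l j i =
  (setOf l i ⊂ setOf l j)
  × (∀ k → setOf l i ⊂ setOf l k → setOf l j ⊆ setOf l k)

record ZSolution {n m b} (D : Digraph n m) (r : Fin n) (t : Fin b → Fin n) (l : Laminar b) : Set where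
  field
    start : Fin (length (sets l)) → Fin n
    end : Fin (length (sets l)) → Fin n
    P : ∀ i → Path D (start i) (end i)
    rootStart : ∀ i → setOf l i ≡ ⊤ → start i ≡ r
    parentStart : ∀ i j → setOf l i ≢ ⊤ → IsParent l j i → start i ≡ end j
    terminalEnd : ∀ i (k : Fin b) → setOf l i ≡ ⁅ k ⁆ → end i ≡ t k
open ZSolution public

zCost : ∀ {n m b} {D : Digraph n m} {r : Fin n} {t : Fin b → Fin n} {l : Laminar b}
  → (Fin m → ℚ) → ZSolution D r t l → ℚ
zCost {l = l} c z = sumFin (length (sets l)) (λ i → pathCost c (P z i))

IsOptZ : ∀ {n m b} (D : Digraph n m) → (Fin m → ℚ) → Fin n → (Fin b → Fin n) → Laminar b → ℚ → Set
IsOptZ D c r t l opt =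
  (Σ (ZSolution D r t l) (λ z → zCost c z ≡ opt))
  × (∀ (z : ZSolution D r t l) → opt Data.Rational.≤ zCost c z)

module Submission where

-- Fix an optimal Steiner tree F (cost OPT) and build the
-- "star" solution of Z_l: every path P_s starts at the root r; for a
-- singleton s = {k} it is the tree path from r to t_k, and for every other
-- s it is the trivial path at r.  The start condition for non-root sets
-- holds because a parent is never a singleton (it strictly contains a
-- nonempty set), so every parent path ends at r.  Each tree path has
-- distinct arcs, all in F, so it costs at most c(F) = OPT; the family
-- contains each singleton at most once, so at most b paths are nontrivial
-- and the star solution costs at most b · OPT, whence OPT(l) ≤ b · OPT.

open import Defs
open import Data.Nat using (ℕ; _≤_; zero; suc)
open import Data.Fin using (Fin; zero; suc)
open import Data.Integer using (+_) renaming (_+_ to _+ℤ_)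
open import Data.Rational using (ℚ; 0ℚ; 1ℚ; _+_; _*_; _/_; toℚᵘ; fromℚᵘ) renaming (_≤_ to _≤ℚ_; _<_ to _<ℚ_)
open import Function.Definitions using (Injective)
import Data.Rational.Properties as ℚ
import Data.Rational.Unnormalised as ℚᵘ
import Data.Rational.Unnormalised.Properties as ℚᵘ
import Data.Integer.Properties as ℤ
import Data.Bool as Bool
open import Data.Bool using (true; false; if_then_else_)
open import Data.List using (List; []; _∷_; length)
import Data.List as List
open import Data.List.Relation.Unary.All as All using (All; []; _∷_)
open import Data.List.Relation.Unary.Any using (here; there)
open import Data.List.Relation.Unary.Unique.Propositional using (Unique)
open import Data.List.Relation.Unary.AllPairs using ([]; _∷_)
open import Data.List.Membership.Propositional using (_∈_)
open import Data.List.Membership.Propositional.Properties using (∈-lookup)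
open import Data.Product using (∃; _,_; proj₁)
open import Data.Vec using (lookup)
import Data.Vec.Properties as Vec
open import Data.Fin.Subset using (Subset; ⁅_⁆; Nonempty; _⊂_) renaming (_∈_ to _∈ₛ_)
open import Data.Fin.Subset.Properties using (x∈⁅x⁆; x∈⁅y⁆⇒x≡y)
open import Data.Fin.Properties using (any?)
open import Relation.Nullary using (Dec; yes; no; ¬_)
open import Data.Empty using (⊥-elim)
open import Relation.Binary.PropositionalEquality using (_≡_; _≢_; refl; sym; trans; cong; cong₂; subst; module ≡-Reasoning)

Nonneg : ∀ {m} → (Fin m → ℚ) → Set
Nonneg g = ∀ a → 0ℚ ≤ℚ g a

sumFin-mono : ∀ k {f g : Fin k → ℚ} → (∀ i → f i ≤ℚ g i) → sumFin k f ≤ℚ sumFin k g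
sumFin-mono zero     f≤g = ℚ.≤-refl
sumFin-mono (suc k) f≤g = ℚ.+-mono-≤ (f≤g zero) (sumFin-mono k (λ i → f≤g (suc i)))

sumFin-nonneg : ∀ k (g : Fin k → ℚ) → Nonneg g → 0ℚ ≤ℚ sumFin k g
sumFin-nonneg k g g≥0 = subst (_≤ℚ sumFin k g) (sumFin-zero k) (sumFin-mono k g≥0)
  where
  sumFin-zero : ∀ k → sumFin k (λ _ → 0ℚ) ≡ 0ℚ
  sumFin-zero zero    = refl
  sumFin-zero (suc k) = cong (λ y → 0ℚ + y) (sumFin-zero k)

erase : ∀ {m} → Fin m → (Fin m → ℚ) → Fin m → ℚ
erase zero    g zero    = 0ℚ
erase zero    g (suc a) = g (suc a)
erase (suc x) g zero    = g zero
erase (suc x) g (suc a) = erase x (λ i → g (suc i)) a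

erase-other : ∀ {m} (x : Fin m) g a → x ≢ a → erase x g a ≡ g a
erase-other zero    g zero    x≢a = ⊥-elim (x≢a refl)
erase-other zero    g (suc a) x≢a = refl
erase-other (suc x) g zero    x≢a = refl
erase-other (suc x) g (suc a) x≢a = erase-other x (λ i → g (suc i)) a (λ x≡a → x≢a (cong suc x≡a))

erase-nonneg : ∀ {m} (x : Fin m) g → Nonneg g → Nonneg (erase x g)
erase-nonneg zero    g g≥0 zero    = ℚ.≤-refl
erase-nonneg zero    g g≥0 (suc a) = g≥0 (suc a)
erase-nonneg (suc x) g g≥0 zero    = g≥0 zero
erase-nonneg (suc x) g g≥0 (suc a) = erase-nonneg x (λ i → g (suc i)) (λ i → g≥0 (suc i)) a

sumFin-erase : ∀ k (x : Fin k) g → sumFin k g ≡ g x + sumFin k (erase x g)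
sumFin-erase (suc k) zero    g = cong (λ y → g zero + y) (sym (ℚ.+-identityˡ _))
sumFin-erase (suc k) (suc x) g = begin
  g zero + sumFin k g′                   ≡⟨ cong (λ y → g zero + y) (sumFin-erase k x g′) ⟩
  g zero + (g′ x + rest)                 ≡⟨ sym (ℚ.+-assoc (g zero) (g′ x) rest) ⟩
  (g zero + g′ x) + rest                 ≡⟨ cong (_+ rest) (ℚ.+-comm (g zero) (g′ x)) ⟩
  (g′ x + g zero) + rest                 ≡⟨ ℚ.+-assoc (g′ x) (g zero) rest ⟩
  g′ x + (g zero + rest)                 ∎
  where
  open ≡-Reasoning
  g′ = λ i → g (suc i)
  rest = sumFin k (erase x g′)

costList-cong : ∀ {m} (f g : Fin m → ℚ) xs → All (λ a → f a ≡ g a) xs → costList f xs ≡ costList g xs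
costList-cong f g []       []         = refl
costList-cong f g (x ∷ xs) (fx≡gx ∷ eqs) = cong₂ _+_ fx≡gx (costList-cong f g xs eqs)

costList≤sumFin : ∀ {m} (g : Fin m → ℚ) → Nonneg g → (xs : List (Fin m)) → Unique xs
  → costList g xs ≤ℚ sumFin m g
costList≤sumFin {m} g g≥0 []       _            = sumFin-nonneg m g g≥0
costList≤sumFin {m} g g≥0 (x ∷ xs) (x∉xs ∷ uniq) = begin
  g x + costList g xs               ≡⟨ cong (λ y → g x + y) (costList-cong g (erase x g) xs unaffected) ⟩
  g x + costList (erase x g) xs     ≤⟨ ℚ.+-monoʳ-≤ (g x) (costList≤sumFin (erase x g) (erase-nonneg x g g≥0) xs uniq) ⟩
  g x + sumFin m (erase x g)        ≡⟨ sym (sumFin-erase m x g) ⟩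
  sumFin m g                        ∎
  where
  open ℚ.≤-Reasoning
  unaffected : All (λ a → g a ≡ erase x g a) xs
  unaffected = All.map (λ {a} x≢a → sym (erase-other x g a x≢a)) x∉xs

/1-suc : ∀ k → + suc k / 1 ≡ 1ℚ + + k / 1
/1-suc k = begin
  fromℚᵘ (ℚᵘ.mkℚᵘ (+ suc k) 0)    ≡⟨ ℚ.fromℚᵘ-cong sum≃ ⟩
  fromℚᵘ (toℚᵘ (1ℚ + + k / 1))    ≡⟨ ℚ.fromℚᵘ-toℚᵘ (1ℚ + + k / 1) ⟩
  1ℚ + + k / 1                     ∎
  where
  open ≡-Reasoning
  -- In unnormalised rationals (k+1)/1 = 1/1 + k/1 is integer arithmetic.
  sum≃ : ℚᵘ.mkℚᵘ (+ suc k) 0 ℚᵘ.≃ toℚᵘ (1ℚ + + k / 1)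
  sum≃ = ℚᵘ.≃-trans unnormalised (ℚᵘ.≃-sym (ℚᵘ.≃-trans (ℚ.toℚᵘ-homo-+ 1ℚ (+ k / 1))
           (ℚᵘ.+-cong (ℚ.toℚᵘ-fromℚᵘ (ℚᵘ.mkℚᵘ (+ 1) 0)) (ℚ.toℚᵘ-fromℚᵘ (ℚᵘ.mkℚᵘ (+ k) 0)))))
    where
    unnormalised : ℚᵘ.mkℚᵘ (+ suc k) 0 ℚᵘ.≃ ℚᵘ.mkℚᵘ (+ 1) 0 ℚᵘ.+ ℚᵘ.mkℚᵘ (+ k) 0
    unnormalised = ℚᵘ.*≡* (trans (ℤ.*-identityʳ (+ suc k))
      (sym (trans (ℤ.*-identityʳ _) (cong (λ z → + 1 +ℤ z) (ℤ.*-identityʳ (+ k))))))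

sumFin-const : ∀ k x → sumFin k (λ _ → x) ≡ (+ k / 1) * x
sumFin-const zero    x = sym (ℚ.*-zeroˡ x)
sumFin-const (suc k) x = begin
  x + sumFin k (λ _ → x)           ≡⟨ cong (λ y → x + y) (sumFin-const k x) ⟩
  x + (+ k / 1) * x                ≡⟨ cong (_+ (+ k / 1) * x) (sym (ℚ.*-identityˡ x)) ⟩
  1ℚ * x + (+ k / 1) * x           ≡⟨ sym (ℚ.*-distribʳ-+ x 1ℚ (+ k / 1)) ⟩
  (1ℚ + + k / 1) * x               ≡⟨ cong (_* x) (sym (/1-suc k)) ⟩
  (+ suc k / 1) * x                ∎
  where open ≡-Reasoning

arc∈⇒tail∈verts : ∀ {n m} {D : Digraph n m} {u v} (w : Walk D u v) {a}
  → a ∈ arcs w → tail D a ∈ verts w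
arc∈⇒tail∈verts (a ∷ w) (here refl) = here refl
arc∈⇒tail∈verts (a ∷ w) (there a∈w) = there (arc∈⇒tail∈verts w a∈w)

-- A walk with pairwise distinct vertices uses pairwise distinct arcs
-- (two occurrences of one arc would leave its tail twice).
simple⇒arcs-distinct : ∀ {n m} {D : Digraph n m} {u v} (w : Walk D u v)
  → Unique (verts w) → Unique (arcs w)
simple⇒arcs-distinct []      _               = []
simple⇒arcs-distinct {D = D} (a ∷ w) (tail∉w ∷ simple) =
  All.tabulate (λ a′∈w a≡a′ → All.lookup tail∉w (arc∈⇒tail∈verts w a′∈w) (cong (tail D) a≡a′))
  ∷ simple⇒arcs-distinct w simple

restrict : ∀ {m} → (Fin m → ℚ) → Subset m → Fin m → ℚ
restrict c F a = if lookup F a then c a else 0ℚ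

restrict-nonneg : ∀ {m} (c : Fin m → ℚ) F → Nonneg c → Nonneg (restrict c F)
restrict-nonneg c F c≥0 a with lookup F a
... | true  = c≥0 a
... | false = ℚ.≤-refl

restrict-inside : ∀ {m} (c : Fin m → ℚ) F a → lookup F a ≡ true → c a ≡ restrict c F a
restrict-inside c F a a∈F rewrite a∈F = refl

subsetCost-nonneg : ∀ {m} (c : Fin m → ℚ) F → Nonneg c → 0ℚ ≤ℚ subsetCost c F
subsetCost-nonneg {m} c F c≥0 = sumFin-nonneg m (restrict c F) (restrict-nonneg c F c≥0)

-- A directed path inside F costs at most c(F), as its arcs are distinct
-- arcs of F.
pathIn-cost≤ : ∀ {n m} {D : Digraph n m} {u v} (c : Fin m → ℚ) F → Nonneg c
  → (p : PathIn D F u v) → pathCost c (proj₁ p) ≤ℚ subsetCost c F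
pathIn-cost≤ c F c≥0 (path w simple , arcs∈F) = begin
  costList c (arcs w)               ≡⟨ costList-cong c (restrict c F) (arcs w)
                                         (All.map (restrict-inside c F _) arcs∈F) ⟩
  costList (restrict c F) (arcs w)  ≤⟨ costList≤sumFin (restrict c F) (restrict-nonneg c F c≥0)
                                         (arcs w) (simple⇒arcs-distinct w simple) ⟩
  subsetCost c F                    ∎
  where open ℚ.≤-Reasoning

-- s is a singleton {k}; decidable since subsets are bit vectors.
IsSingleton : ∀ {b} → Subset b → Set
IsSingleton s = ∃ λ k → s ≡ ⁅ k ⁆

singleton? : ∀ {b} (s : Subset b) → Dec (IsSingleton s)
singleton? s = any? (λ k → Vec.≡-dec Bool._≟_ s ⁅ k ⁆)

⁅⁆-injective : ∀ {b} {k k′ : Fin b} → ⁅ k ⁆ ≡ ⁅ k′ ⁆ → k ≡ k′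
⁅⁆-injective {k = k} {k′} eq = x∈⁅y⁆⇒x≡y k′ (subst (k ∈ₛ_) eq (x∈⁅x⁆ k))

nonempty⊄singleton : ∀ {b} {s : Subset b} {k} → Nonempty s → ¬ (s ⊂ ⁅ k ⁆)
nonempty⊄singleton {s = s} {k} (y , y∈s) (s⊆k , x , x∈k , x∉s) =
  x∉s (subst (_∈ₛ s) (trans (x∈⁅y⁆⇒x≡y k (s⊆k y∈s)) (sym (x∈⁅y⁆⇒x≡y k x∈k))) y∈s)

parent-not-singleton : ∀ {b} (l : Laminar b) i j → IsParent l j i → ¬ IsSingleton (setOf l j)
parent-not-singleton l i j (i⊂j , _) (k , j≡⁅k⁆) =
  nonempty⊄singleton (All.lookup (nonempty l) (∈-lookup i)) (subst (setOf l i ⊂_) j≡⁅k⁆ i⊂j)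

singletonKeys : ∀ {b} → List (Subset b) → List (Fin b)
singletonKeys []       = []
singletonKeys (s ∷ ss) with singleton? s
... | yes (k , _) = k ∷ singletonKeys ss
... | no  _       = singletonKeys ss

singletonKeys-sound : ∀ {b} (ss : List (Subset b)) {k} → k ∈ singletonKeys ss → ⁅ k ⁆ ∈ ss
singletonKeys-sound (s ∷ ss) k∈ with singleton? s | k∈
... | yes (k , s≡⁅k⁆) | here refl = here (sym s≡⁅k⁆)
... | yes _           | there k∈′ = there (singletonKeys-sound ss k∈′)
... | no  _           | k∈′       = there (singletonKeys-sound ss k∈′)

singletonKeys-distinct : ∀ {b} (ss : List (Subset b)) → Unique ss → Unique (singletonKeys ss)
singletonKeys-distinct []       _              = []
singletonKeys-distinct (s ∷ ss) (s∉ss ∷ uniq) with singleton? s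
... | yes (k , s≡⁅k⁆) =
  All.tabulate (λ k′∈ k≡k′ → All.lookup s∉ss (singletonKeys-sound ss k′∈) (trans s≡⁅k⁆ (cong ⁅_⁆ k≡k′)))
  ∷ singletonKeys-distinct ss uniq
... | no _ = singletonKeys-distinct ss uniq

onSingletons : ∀ {b} → ℚ → Subset b → ℚ
onSingletons x s with singleton? s
... | yes _ = x
... | no  _ = 0ℚ

onSingletons-sum : ∀ {b} x (ss : List (Subset b))
  → sumFin (length ss) (λ i → onSingletons x (List.lookup ss i)) ≡ costList (λ _ → x) (singletonKeys ss)
onSingletons-sum x []       = refl
onSingletons-sum x (s ∷ ss) with singleton? s
... | yes _ = cong (λ y → x + y) (onSingletons-sum x ss)
... | no  _ = trans (ℚ.+-identityˡ _) (onSingletons-sum x ss)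

onSingletons-sum≤ : ∀ {b} x → 0ℚ ≤ℚ x → (ss : List (Subset b)) → Unique ss
  → sumFin (length ss) (λ i → onSingletons x (List.lookup ss i)) ≤ℚ (+ b / 1) * x
onSingletons-sum≤ {b} x x≥0 ss uniq = begin
  sumFin (length ss) (λ i → onSingletons x (List.lookup ss i))  ≡⟨ onSingletons-sum x ss ⟩
  costList (λ _ → x) (singletonKeys ss)   ≤⟨ costList≤sumFin (λ _ → x) (λ _ → x≥0) _ (singletonKeys-distinct ss uniq) ⟩
  sumFin b (λ _ → x)                      ≡⟨ sumFin-const b x ⟩
  (+ b / 1) * x                           ∎
  where open ℚ.≤-Reasoning

module Star {n m b} (D : Digraph n m) (r : Fin n) (t : Fin b → Fin n) (F : Subset m)
            (treePath : ∀ k → PathIn D F r (t k)) (l : Laminar b) where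

  target : ∀ {s : Subset b} → Dec (IsSingleton s) → Fin n
  target (yes (k , _)) = t k
  target (no  _)       = r

  route : ∀ {s : Subset b} (d : Dec (IsSingleton s)) → Path D r (target d)
  route (yes (k , _)) = proj₁ (treePath k)
  route (no  _)       = path [] ([] ∷ [])

  target-singleton : ∀ {s : Subset b} k → s ≡ ⁅ k ⁆ → (d : Dec (IsSingleton s)) → target d ≡ t k
  target-singleton k s≡⁅k⁆ (yes (k′ , s≡⁅k′⁆)) = cong t (⁅⁆-injective (trans (sym s≡⁅k′⁆) s≡⁅k⁆))
  target-singleton k s≡⁅k⁆ (no ¬singleton)     = ⊥-elim (¬singleton (k , s≡⁅k⁆))

  target-nonsingleton : ∀ {s : Subset b} → ¬ IsSingleton s → (d : Dec (IsSingleton s)) → r ≡ target d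
  target-nonsingleton ¬singleton (yes singleton) = ⊥-elim (¬singleton singleton)
  target-nonsingleton ¬singleton (no _)          = refl

  -- Every child starts at r, which is where its (non-singleton) parent ends.
  solution : ZSolution D r t l
  solution = record
    { start       = λ _ → r
    ; end         = λ i → target (singleton? (setOf l i))
    ; P           = λ i → route (singleton? (setOf l i))
    ; rootStart   = λ _ _ → refl
    ; parentStart = λ i j _ j-parent → target-nonsingleton (parent-not-singleton l i j j-parent) (singleton? (setOf l j))
    ; terminalEnd = λ i k i≡⁅k⁆ → target-singleton k i≡⁅k⁆ (singleton? (setOf l i))
    }

  route-cost≤ : ∀ c → Nonneg c → (s : Subset b)
    → pathCost c (route (singleton? s)) ≤ℚ onSingletons (subsetCost c F) s
  route-cost≤ c c≥0 s with singleton? s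
  ... | yes (k , _) = pathIn-cost≤ c F c≥0 (treePath k)
  ... | no  _       = ℚ.≤-refl

  solution-cost≤ : ∀ c → Nonneg c → zCost c solution ≤ℚ (+ b / 1) * subsetCost c F
  solution-cost≤ c c≥0 =
    ℚ.≤-trans (sumFin-mono (length (sets l)) (λ i → route-cost≤ c c≥0 (setOf l i)))
              (onSingletons-sum≤ (subsetCost c F) (subsetCost-nonneg c F c≥0) (sets l) (distinct l))

lemma1 : ∀ {n m b : ℕ} (D : Digraph n m) (c : Fin m → ℚ) (r : Fin n) (t : Fin b → Fin n)
    → (∀ a → 0ℚ <ℚ c a)
    → 1 ≤ b
    → Injective _≡_ _≡_ t
    → (∀ k → t k ≢ r)
    → (∀ k → Path D r (t k))
    → (opt : ℚ) → IsOptSteiner D c r t opt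
    → (l : Laminar b) → (optl : ℚ) → IsOptZ D c r t l optl
    → optl ≤ℚ ((+ b / 1) * opt)
lemma1 {b = b} D c r t c>0 _ _ _ _ opt ((F , (_ , treePath) , cF≡opt) , _) l optl (_ , optl-minimal) =
  begin
    optl                          ≤⟨ optl-minimal solution ⟩
    zCost c solution              ≤⟨ solution-cost≤ c c≥0 ⟩
    (+ b / 1) * subsetCost c F    ≡⟨ cong ((+ b / 1) *_) cF≡opt ⟩
    (+ b / 1) * opt               ∎
  where
  open ℚ.≤-Reasoning
  open Star D r t F treePath l
  c≥0 : Nonneg c
  c≥0 a = ℚ.<⇒≤ (c>0 a)
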